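{- Let $\lambda$ be a partition, $\pi$ a reverse plane partition of shape $\lambda$, $u\in\lambda\setminus\mathrm{cand}(\pi)$ and $v\in\mathrm{cand}(\pi)$ such that $(Q(v,\pi),\pi)$ is compatible and $\pi-Q(v,\pi)$ is a reverse plane partition. If $u\triangleleft v$, then $u\notin\mathrm{cand}(\pi-Q(v,\pi))$.
   Context: Cells are pairs $(i,j)\in\mathbb Z^2$; $\mathrm n(i,j)=(i-1,j)$, $\mathrm e(i,j)=(i,j+1)$, $\mathrm s(i,j)=(i+1,j)$, $\mathrm w(i,j)=(i,j-1)$. A partition $\lambda$ is identified with its Young diagram. A reverse plane partition of shape $\lambda$ is $\pi:\lambda\to\mathbb N$ with $\pi(u)\le\pi(\mathrm e u),\pi(\mathrm s u)$, with conventions $\pi(i,j)=0$ if $i\le0$ or $j\le0$, $\pi(i,j)=\infty$ if $i,j\ge1$, $(i,j)\notin\lambda$. Content $c(i,j)=j-i$; outer corner: $u\in\lambda$, $\mathrm e u,\mathrm s u\notin\lambda$; inner corner: $\mathrm e u,\mathrm s u\in\lambda$, $\mathrm e\mathrm s u\notin\lambda$. With inner corner contents $i_1<\dots<i_r$ and outer corner contents $o_1<\dots<o_{r+1}$ (interlacing), $\mathcal I=\{u\in\lambda:c(u)=i_k\}$, $\mathcal O=\{u\in\lambda:c(u)=o_k\}$, $\mathcal A=\{u\in\lambda:c(u)<o_1\text{ or }i_k<c(u)<o_{k+1}\text{ for some }k\in[r]\}$, $\mathcal B=\{u\in\lambda:o_k<c(u)<i_k\text{ for some }k\in[r]\text{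 or }c(u)>o_{r+1}\}$. Content order: $(i,j)\trianglelefteq(k,l)$ iff $j-i>l-k$, or $j-i=l-k$ and $i\ge k$; $\triangleleft$ is its strict version. Candidates: $\mathrm{cand}(\pi)=\{u\in\mathcal O:\pi(u)>\pi(\mathrm w u)\}\cup\{u\in\mathcal A:\pi(u)>\pi(\mathrm w u),\pi(u)>\pi(\mathrm n u)\}$. A north-east path is $(u_0,\dots,u_s)$ in $\lambda$ with $u_k\in\{\mathrm n u_{k-1},\mathrm e u_{k-1}\}$. $(\pi-P)(u)=\pi(u)-1$ for $u\in P$, else $\pi(u)$. $(P,\pi)$ compatible: $u\in P\cap(\mathcal I\cup\mathcal A)$ implies $\mathrm e u\in P$ and $\pi(u)=\pi(\mathrm e u)$; $u,\mathrm s u\in P$ implies $\pi(u)=\pi(\mathrm s u)$. For $v\in\mathrm{cand}(\pi)$, $Q(v,\pi)$ is the north-east path starting at $v$ which, from current cell $u$, moves to $\mathrm n u$ if $u\in\mathcal O\cup\mathcal B$ and $\pi(u)=\pi(\mathrm n u)$; to $\mathrm e u$ if $u\in\mathcal I\cup\mathcal A$, or if $\mathrm e u\in\lambda$ and $\pi(u)>\pi(\mathrm n u)$; and terminates if $\pi(u)>\pi(\mathrm n u)$ and $\mathrm e u\notin\lambda$. -}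

module Defs where

open import Data.Nat as ℕ using (ℕ; zero; suc; _∸_; _≤?_)
open import Data.Nat.Properties using () renaming (_≟_ to _≟ℕ_)
open import Data.Integer as ℤ using (ℤ; +_; _-_)
open import Data.Fin using (Fin; zero; suc; inject₁; fromℕ)
open import Data.List using (List; []; _∷_; lookup; length)
open import Data.List.Relation.Unary.Linked using (Linked)
open import Data.List.Membership.Propositional using (_∈_)
open import Data.Product using (Σ; ∃; _×_; _,_)
open import Data.Product.Properties using (≡-dec)
open import Data.Sum using (_⊎_)
open import Data.Bool using (if_then_else_)
open import Relation.Nullary using (¬_; yes; no; does)
open import Relation.Binary.PropositionalEquality using (_≡_; _≢_)
open import Function.Bundles using (_⇔_)

Cell : Set
Cell = ℕ × ℕ

-- Coordinates are naturals: only cells with row/column 0 can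
-- arise as n u / w u of a cell u of a diagram, and such cells get value 0
-- by the convention below (exactly as cells with i ≤ 0 or j ≤ 0 do).
nC eC sC wC : Cell → Cell
nC (i , j) = (i ∸ 1 , j)
eC (i , j) = (i , suc j)
sC (i , j) = (suc i , j)
wC (i , j) = (i , j ∸ 1)

content : Cell → ℤ
content (i , j) = + j - + i

-- A partition: a weakly decreasing list of parts λ₁ ≥ λ₂ ≥ ⋯ (zero parts
-- allowed; they do not change the diagram).
record Partition : Set where
  field
    parts      : List ℕ
    decreasing : Linked ℕ._≥_ parts

open Partition public

-- length of row i (rows numbered from 1); 0 beyond the last part
rowLen : List ℕ → ℕ → ℕ
rowLen []       _             = 0
rowLen (x ∷ xs) zero          = 0
rowLen (x ∷ xs) (suc zero)    = x
rowLen (x ∷ xs) (suc (suc i)) = rowLen xs (suc i)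

_∈Y_ : Cell → Partition → Set
(i , j) ∈Y lam = (1 ℕ.≤ i) × (1 ℕ.≤ j) × (j ℕ.≤ rowLen (parts lam) i)

_∉Y_ : Cell → Partition → Set
u ∉Y lam = ¬ (u ∈Y lam)

data ℕ∞ : Set where
  fin : ℕ → ℕ∞
  ∞   : ℕ∞

data _≤∞_ : ℕ∞ → ℕ∞ → Set where
  fin≤fin : ∀ {m n} → m ℕ.≤ n → fin m ≤∞ fin n
  _≤∞∞    : ∀ x → x ≤∞ ∞

data _<∞_ : ℕ∞ → ℕ∞ → Set where
  fin<fin : ∀ {m n} → m ℕ.< n → fin m <∞ fin n
  fin<∞   : ∀ {m} → fin m <∞ ∞

-- A filling of cells by naturals; only its values on lam matter.
Filling : Set
Filling = Cell → ℕ

val : Partition → Filling → Cell → ℕ∞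
val lam π (zero , j)    = fin 0
val lam π (suc i , zero) = fin 0
val lam π (suc i , suc j) with suc j ≤? rowLen (parts lam) (suc i)
... | yes _ = fin (π (suc i , suc j))
... | no  _ = ∞

IsRPP : Partition → Filling → Set
IsRPP lam π = ∀ u → u ∈Y lam →
  (val lam π u ≤∞ val lam π (eC u)) × (val lam π u ≤∞ val lam π (sC u))

OuterCorner : Partition → Cell → Set
OuterCorner lam u = (u ∈Y lam) × (eC u ∉Y lam) × (sC u ∉Y lam)

InnerCorner : Partition → Cell → Set
InnerCorner lam u = (eC u ∈Y lam) × (sC u ∈Y lam) × (eC (sC u) ∉Y lam)

StrictlyIncreasing : ∀ {m} → (Fin m → ℤ) → Set
StrictlyIncreasing {m} f = ∀ (a b : Fin m) → Data.Fin._<_ a b → f a ℤ.< f b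

-- The contents i₁ < ⋯ < i_r of the inner corners and o₁ < ⋯ < o_{r+1}
-- of the outer corners, listed in increasing order (Fin-indexed from 0,
-- so ins k = i_{k+1}, outs k = o_{k+1}).
record CornerContents (lam : Partition) : Set where
  field
    r        : ℕ
    ins      : Fin r → ℤ
    outs     : Fin (suc r) → ℤ
    ins-inc  : StrictlyIncreasing ins
    outs-inc : StrictlyIncreasing outs
    ins-spec  : ∀ c → (∃ λ u → InnerCorner lam u × content u ≡ c) ⇔ (∃ λ k → ins k ≡ c)
    outs-spec : ∀ c → (∃ λ u → OuterCorner lam u × content u ≡ c) ⇔ (∃ λ k → outs k ≡ c)

open CornerContents public

module _ {lam : Partition} (cc : CornerContents lam) where

  𝓘 : Cell → Set
  𝓘 u = (u ∈Y lam) × ∃ λ k → content u ≡ ins cc k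

  𝓞 : Cell → Set
  𝓞 u = (u ∈Y lam) × ∃ λ k → content u ≡ outs cc k

  𝓐 : Cell → Set
  𝓐 u = (u ∈Y lam) ×
        ((content u ℤ.< outs cc zero) ⊎
         (∃ λ (k : Fin (r cc)) → (ins cc k ℤ.< content u) × (content u ℤ.< outs cc (suc k))))

  𝓑 : Cell → Set
  𝓑 u = (u ∈Y lam) ×
        ((∃ λ (k : Fin (r cc)) → (outs cc (inject₁ k) ℤ.< content u) × (content u ℤ.< ins cc k)) ⊎
         (outs cc (fromℕ (r cc)) ℤ.< content u))

  cand : Filling → Cell → Set
  cand π u =
    (𝓞 u × (val lam π (wC u) <∞ val lam π u)) ⊎
    (𝓐 u × (val lam π (wC u) <∞ val lam π u) × (val lam π (nC u) <∞ val lam π u))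

  Compatible : List Cell → Filling → Set
  Compatible P π =
    (∀ u → u ∈ P → (𝓘 u ⊎ 𝓐 u) → (eC u ∈ P) × (val lam π u ≡ val lam π (eC u))) ×
    (∀ u → u ∈ P → sC u ∈ P → val lam π u ≡ val lam π (sC u))

  data IsQ (π : Filling) : Cell → List Cell → Set where
    north : ∀ {u P} → u ∈Y lam → (𝓞 u ⊎ 𝓑 u) → val lam π u ≡ val lam π (nC u) →
            IsQ π (nC u) P → IsQ π u (u ∷ P)
    eastIA : ∀ {u P} → u ∈Y lam → (𝓘 u ⊎ 𝓐 u) →
            IsQ π (eC u) P → IsQ π u (u ∷ P)
    eastGt : ∀ {u P} → u ∈Y lam → eC u ∈Y lam → val lam π (nC u) <∞ val lam π u →
            IsQ π (eC u) P → IsQ π u (u ∷ P)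
    stop  : ∀ {u} → u ∈Y lam → val lam π (nC u) <∞ val lam π u → eC u ∉Y lam →
            IsQ π u (u ∷ [])

_∈?C_ : (u : Cell) (P : List Cell) → Relation.Nullary.Dec (u ∈ P)
u ∈?C P = u ∈?D P
  where open import Data.List.Membership.DecPropositional (≡-dec _≟ℕ_ _≟ℕ_) using () renaming (_∈?_ to _∈?D_)

_−P_ : Filling → List Cell → Filling
(π −P P) u = if does (u ∈?C P) then π u ∸ 1 else π u

_⊴_ : Cell → Cell → Set
(i , j) ⊴ (k , l) = (content (k , l) ℤ.< content (i , j)) ⊎
                    ((content (i , j) ≡ content (k , l)) × (k ℕ.≤ i))

_◁_ : Cell → Cell → Set
u ◁ v = (u ⊴ v) × (u ≢ v)

-- Subtracting Q only lowers entries, so a strict inequality π'(x) < π'(u) with π' = π − Q and x a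
-- west or north neighbour of u that fails for π needs x ∈ Q.  The west neighbour of a cell of 𝓞 ∪ 𝓐
-- lies in 𝓘 ∪ 𝓐 (corner contents interlace), so compatibility puts u on Q with π(w u) = π(u) and both
-- entries drop together.  If u ∈ 𝓐 and Q passes through n u but not through u, then n u is not the
-- start v (as u ◁ v), so Q enters n u from the west, from the cell n w u of 𝓐 on the diagonal of u;
-- compatibility and the RPP condition give π(n u) = π(n w u) ≤ π(w u) < π(u).  Either way u would
-- already be a candidate of π.
module Submission where

open import Defs
open import Data.Empty using (⊥-elim)
open import Data.Fin as Fin using (Fin; toℕ; inject₁)
import Data.Fin.Properties as Finₚ
open import Data.Integer as ℤ using (ℤ; +_)
import Data.Integer.Properties as ℤₚ
open import Data.Integer.Tactic.RingSolver using (solve-∀)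
open import Data.List using (List; []; _∷_)
open import Data.List.Membership.Propositional using (_∈_; _∉_)
open import Data.List.Relation.Unary.Any using (here; there)
open import Data.List.Relation.Unary.Linked using (Linked; _∷_)
open import Data.Nat as ℕ using (ℕ; zero; suc; _∸_; z≤n; s≤s; _≤?_)
import Data.Nat.Properties as ℕₚ
open import Data.Product using (_×_; _,_; proj₁; proj₂; ∃)
open import Data.Sum using (_⊎_; inj₁; inj₂)
open import Function using (_∘_)
open import Function.Bundles using (Equivalence)
open import Relation.Binary.Definitions using (tri<; tri≈; tri>)
open import Relation.Binary.PropositionalEquality
open import Relation.Nullary using (¬_; yes; no)

i<suc[i] : ∀ i → i ℤ.< ℤ.suc i
i<suc[i] i = ℤₚ.suc[i]≤j⇒i<j ℤₚ.≤-refl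

i<suc[j]⇒i≤j : ∀ {i j} → i ℤ.< ℤ.suc j → i ℤ.≤ j
i<suc[j]⇒i≤j {j = j} i<sj = subst (_ ℤ.≤_) (ℤₚ.pred-suc j) (ℤₚ.i<j⇒i≤pred[j] i<sj)

content-eC : ∀ x → content (eC x) ≡ ℤ.suc (content x)
content-eC (i , j) = identity (+ j) (+ i)
  where
  identity : ∀ J I → (+ 1 ℤ.+ J) ℤ.- I ≡ + 1 ℤ.+ (J ℤ.- I)
  identity = solve-∀

content-nC : ∀ i j → content (i , j) ≡ ℤ.suc (content (suc i , j))
content-nC i j = identity (+ j) (+ i)
  where
  identity : ∀ J I → J ℤ.- I ≡ + 1 ℤ.+ (J ℤ.- (+ 1 ℤ.+ I))
  identity = solve-∀

content-diagonal : ∀ i j → content (suc i , suc j) ≡ content (i , j)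
content-diagonal i j = trans (content-eC (suc i , j)) (sym (content-nC i j))

content<content-eC : ∀ x → content x ℤ.< content (eC x)
content<content-eC x = subst (content x ℤ.<_) (sym (content-eC x)) (i<suc[i] (content x))

-- Adding + (a + b) clears both subtractions, turning comparisons of contents into ones in ℕ.
content+ : ∀ a p b → content (a , p) ℤ.+ + (a ℕ.+ b) ≡ + (p ℕ.+ b)
content+ a p b = identity (+ p) (+ a) (+ b)
  where
  identity : ∀ P A B → (P ℤ.- A) ℤ.+ (A ℤ.+ B) ≡ P ℤ.+ B
  identity = solve-∀

content+′ : ∀ a b q → content (b , q) ℤ.+ + (a ℕ.+ b) ≡ + (q ℕ.+ a)
content+′ a b q = trans (cong (λ n → content (b , q) ℤ.+ + n) (ℕₚ.+-comm a b)) (content+ b q a)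

content-<⇒ : ∀ a p b q → content (a , p) ℤ.< content (b , q) → p ℕ.+ b ℕ.< q ℕ.+ a
content-<⇒ a p b q lt =
  ℤₚ.drop‿+<+ (subst₂ ℤ._<_ (content+ a p b) (content+′ a b q) (ℤₚ.+-monoˡ-< (+ (a ℕ.+ b)) lt))

content-≤⇒ : ∀ a p b q → content (a , p) ℤ.≤ content (b , q) → p ℕ.+ b ℕ.≤ q ℕ.+ a
content-≤⇒ a p b q le =
  ℤₚ.drop‿+≤+ (subst₂ ℤ._≤_ (content+ a p b) (content+′ a b q) (ℤₚ.+-monoˡ-≤ (+ (a ℕ.+ b)) le))

content-<⇐ : ∀ a p b q → p ℕ.+ b ℕ.< q ℕ.+ a → content (a , p) ℤ.< content (b , q)
content-<⇐ a p b q lt = ℤₚ.≰⇒> (ℕₚ.<⇒≱ lt ∘ content-≤⇒ b q a p)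

⊴⇒content-≥ : ∀ {x y} → x ⊴ y → content y ℤ.≤ content x
⊴⇒content-≥ {_ , _} {_ , _} (inj₁ lt)        = ℤₚ.<⇒≤ lt
⊴⇒content-≥ {_ , _} {_ , _} (inj₂ (eq , _)) = ℤₚ.≤-reflexive (sym eq)

⋬-north : ∀ i j → ¬ ((suc i , j) ⊴ (i , j))
⋬-north i j u⊴n =
  ℤₚ.≤⇒≯ (subst (ℤ._≤ content (suc i , j)) (content-nC i j) (⊴⇒content-≥ {suc i , j} {i , j} u⊴n)) (i<suc[i] (content (suc i , j)))

rowLen-suc-≤ : ∀ {xs} → Linked ℕ._≥_ xs → ∀ i → rowLen xs (suc (suc i)) ℕ.≤ rowLen xs (suc i)
rowLen-suc-≤ {[]}         _           _       = z≤n
rowLen-suc-≤ {_ ∷ []}     _           _       = z≤n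
rowLen-suc-≤ {_ ∷ _ ∷ _}  (x≥y ∷ _)   zero    = x≥y
rowLen-suc-≤ {_ ∷ _ ∷ _}  (_ ∷ sorted) (suc i) = rowLen-suc-≤ sorted i

rowLen-antitone : ∀ {xs} → Linked ℕ._≥_ xs → ∀ {i j} → 1 ℕ.≤ i → i ℕ.≤ j → rowLen xs j ℕ.≤ rowLen xs i
rowLen-antitone {xs} sorted {suc _} {suc _} _ (s≤s i≤j) = antitone i≤j
  where
  antitone : ∀ {i j} → i ℕ.≤ j → rowLen xs (suc j) ℕ.≤ rowLen xs (suc i)
  antitone {j = zero}  z≤n = ℕₚ.≤-refl
  antitone {j = suc j} i≤1+j with ℕₚ.m≤n⇒m<n∨m≡n i≤1+j
  ... | inj₂ refl      = ℕₚ.≤-refl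
  ... | inj₁ (s≤s i≤j) = ℕₚ.≤-trans (rowLen-suc-≤ sorted j) (antitone i≤j)

module _ (lam : Partition) where

  private
    row : ℕ → ℕ
    row = rowLen (parts lam)

  outerCorner-rowLen : ∀ {a p} → OuterCorner lam (a , p) → p ≡ row a
  outerCorner-rowLen ((1≤a , _ , p≤row) , e∉λ , _) =
    ℕₚ.≤-antisym p≤row (ℕₚ.≮⇒≥ (λ p<row → e∉λ (1≤a , s≤s z≤n , p<row)))

  outerCorner-rowLen-below : ∀ {a p} → OuterCorner lam (a , p) → row (suc a) ℕ.< p
  outerCorner-rowLen-below ((_ , 1≤p , _) , _ , s∉λ) = ℕₚ.≰⇒> (λ p≤row → s∉λ (s≤s z≤n , 1≤p , p≤row))

  -- Two outer corners y = (a , p), z = (b , q) with content y < content z must have b < a;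
  -- the inner corner is the cell of row b above the last cell of row b + 1.
  innerCorner-between : ∀ y z → OuterCorner lam y → OuterCorner lam z → content y ℤ.< content z →
    ∃ λ w → InnerCorner lam w × content y ℤ.< content w × content w ℤ.< content z
  innerCorner-between (a , p) (b , q) oy oz y<z with ℕₚ.<-cmp a b
  ... | tri< a<b _ _ = ⊥-elim (ℕₚ.<-asym (content-<⇒ a p b q y<z) (ℕₚ.+-mono-<-≤ q<p (ℕₚ.<⇒≤ a<b)))
    where
    q<p : q ℕ.< p
    q<p = ℕₚ.≤-<-trans (ℕₚ.≤-trans (ℕₚ.≤-reflexive (outerCorner-rowLen oz))
                                    (rowLen-antitone (decreasing lam) (s≤s z≤n) a<b))
                        (outerCorner-rowLen-below oy)
  ... | tri≈ _ refl _ =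
    ⊥-elim (ℕₚ.<-irrefl (cong (ℕ._+ a) (trans (outerCorner-rowLen oy) (sym (outerCorner-rowLen oz))))
                        (content-<⇒ a p a q y<z))
  ... | tri> _ _ b<a = (b , q′) , innerCorner , content-<⇐ a p b q′ (ℕₚ.+-mono-≤-< p≤q′ b<a)
                                             , content-<⇐ b q′ b q (ℕₚ.+-monoˡ-< b q′<q)
    where
    q′ : ℕ
    q′ = row (suc b)
    q′<q : q′ ℕ.< q
    q′<q = outerCorner-rowLen-below oz
    p≤q′ : p ℕ.≤ q′
    p≤q′ = subst (ℕ._≤ q′) (sym (outerCorner-rowLen oy)) (rowLen-antitone (decreasing lam) (s≤s z≤n) b<a)
    innerCorner : InnerCorner lam (b , q′)
    innerCorner = ( proj₁ (proj₁ oz) , s≤s z≤n , subst (q′ ℕ.<_) (outerCorner-rowLen oz) q′<q)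
                , ( s≤s z≤n , ℕₚ.≤-trans (proj₁ (proj₂ (proj₁ oy))) p≤q′ , ℕₚ.≤-refl)
                , λ e∈λ → ℕₚ.<-irrefl refl (proj₂ (proj₂ e∈λ))

toℕ≤-strictlyIncreasing : ∀ {n} (f : Fin n → ℕ) → (∀ a b → a Fin.< b → f a ℕ.< f b) → ∀ j → toℕ j ℕ.≤ f j
toℕ≤-strictlyIncreasing f inc Fin.zero    = z≤n
toℕ≤-strictlyIncreasing f inc (Fin.suc j) =
  ℕₚ.≤-<-trans (toℕ≤-strictlyIncreasing (f ∘ inject₁) inc′ j)
               (inc (inject₁ j) (Fin.suc j) (s≤s (ℕₚ.≤-reflexive (Finₚ.toℕ-inject₁ j))))
  where
  inc′ : ∀ a b → a Fin.< b → f (inject₁ a) ℕ.< f (inject₁ b)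
  inc′ a b a<b = inc (inject₁ a) (inject₁ b) (subst₂ ℕ._<_ (sym (Finₚ.toℕ-inject₁ a)) (sym (Finₚ.toℕ-inject₁ b)) a<b)

module _ {n} {f : Fin n → ℤ} (inc : StrictlyIncreasing f) where

  strictlyIncreasing⇒monotone : ∀ a b → toℕ a ℕ.≤ toℕ b → f a ℤ.≤ f b
  strictlyIncreasing⇒monotone a b a≤b with ℕₚ.m≤n⇒m<n∨m≡n a≤b
  ... | inj₁ a<b = ℤₚ.<⇒≤ (inc a b a<b)
  ... | inj₂ a≡b = ℤₚ.≤-reflexive (cong f (Finₚ.toℕ-injective a≡b))

  strictlyIncreasing-reflects-< : ∀ a b → f a ℤ.< f b → a Fin.< b
  strictlyIncreasing-reflects-< a b fa<fb =
    ℕₚ.≰⇒> (λ b≤a → ℤₚ.≤⇒≯ (strictlyIncreasing⇒monotone b a b≤a) fa<fb)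

module _ {lam : Partition} (cc : CornerContents lam) where
  open Equivalence

  private
    innerBetween : ∀ k → ∃ λ m → outs cc (inject₁ k) ℤ.< ins cc m × ins cc m ℤ.< outs cc (Fin.suc k)
    innerBetween k with from (outs-spec cc _) (inject₁ k , refl) | from (outs-spec cc _) (Fin.suc k , refl)
    ... | y , oy , y≡o | z , oz , z≡o
      with innerCorner-between lam y z oy oz (subst₂ ℤ._<_ (sym y≡o) (sym z≡o)
             (outs-inc cc (inject₁ k) (Fin.suc k) (s≤s (ℕₚ.≤-reflexive (Finₚ.toℕ-inject₁ k)))))
    ... | w , iw , y<w , w<z with to (ins-spec cc (content w)) (w , iw , refl)
    ... | m , i≡w = m , subst₂ ℤ._<_ y≡o (sym i≡w) y<w , subst₂ ℤ._<_ (sym i≡w) z≡o w<z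

    innerIndex : Fin (r cc) → Fin (r cc)
    innerIndex k = proj₁ (innerBetween k)

    -- i_{m a} < o_{a+1} ≤ o_b < i_{m b}
    innerIndex-increasing : ∀ a b → a Fin.< b → innerIndex a Fin.< innerIndex b
    innerIndex-increasing a b a<b = strictlyIncreasing-reflects-< (ins-inc cc) (innerIndex a) (innerIndex b)
      (ℤₚ.<-trans (proj₂ (proj₂ (innerBetween a)))
        (ℤₚ.≤-<-trans (strictlyIncreasing⇒monotone (outs-inc cc) (Fin.suc a) (inject₁ b)
                         (subst (toℕ a ℕ.<_) (sym (Finₚ.toℕ-inject₁ b)) a<b))
                      (proj₁ (proj₂ (innerBetween b)))))

  ins<outs-suc : ∀ k → ins cc k ℤ.< outs cc (Fin.suc k)
  ins<outs-suc k =
    ℤₚ.≤-<-trans (strictlyIncreasing⇒monotone (ins-inc cc) k (innerIndex k)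
                   (toℕ≤-strictlyIncreasing (toℕ ∘ innerIndex) innerIndex-increasing k))
                 (proj₂ (proj₂ (innerBetween k)))

module _ {lam : Partition} (cc : CornerContents lam) where

  𝓘⊎𝓐-window : ∀ {x} → x ∈Y lam → ∀ k → ins cc k ℤ.< ℤ.suc (content x) → content x ℤ.< outs cc (Fin.suc k) →
               𝓘 cc x ⊎ 𝓐 cc x
  𝓘⊎𝓐-window {x} x∈λ k i<c+1 c<o with content x ℤₚ.≟ ins cc k
  ... | yes c≡i = inj₁ (x∈λ , k , c≡i)
  ... | no  c≢i = inj₂ (x∈λ , inj₂ (k , ℤₚ.≤∧≢⇒< (i<suc[j]⇒i≤j i<c+1) (c≢i ∘ sym) , c<o))

  west-of-𝓞 : ∀ {x} → x ∈Y lam → 𝓞 cc (eC x) → 𝓘 cc x ⊎ 𝓐 cc x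
  west-of-𝓞 {x} x∈λ (_ , Fin.zero , c≡o) = inj₂ (x∈λ , inj₁ (subst (content x ℤ.<_) c≡o (content<content-eC x)))
  west-of-𝓞 {x} x∈λ (_ , Fin.suc k , c≡o) =
    𝓘⊎𝓐-window x∈λ k (subst (ins cc k ℤ.<_) (trans (sym c≡o) (content-eC x)) (ins<outs-suc cc k))
                      (subst (content x ℤ.<_) c≡o (content<content-eC x))

  west-of-𝓐 : ∀ {x} → x ∈Y lam → 𝓐 cc (eC x) → 𝓘 cc x ⊎ 𝓐 cc x
  west-of-𝓐 {x} x∈λ (_ , inj₁ c<o) = inj₂ (x∈λ , inj₁ (ℤₚ.<-trans (content<content-eC x) c<o))
  west-of-𝓐 {x} x∈λ (_ , inj₂ (k , i<c , c<o)) =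
    𝓘⊎𝓐-window x∈λ k (subst (ins cc k ℤ.<_) (content-eC x) i<c) (ℤₚ.<-trans (content<content-eC x) c<o)

  𝓐-content : ∀ {x y} → x ∈Y lam → content x ≡ content y → 𝓐 cc y → 𝓐 cc x
  𝓐-content x∈λ eq (_ , inj₁ c<o)             = x∈λ , inj₁ (subst (ℤ._< _) (sym eq) c<o)
  𝓐-content x∈λ eq (_ , inj₂ (k , i<c , c<o)) =
    x∈λ , inj₂ (k , subst (_ ℤ.<_) (sym eq) i<c , subst (ℤ._< _) (sym eq) c<o)

<∞-≤∞-trans : ∀ {x y z} → x <∞ y → y ≤∞ z → x <∞ z
<∞-≤∞-trans (fin<fin x<y) (fin≤fin y≤z) = fin<fin (ℕₚ.<-≤-trans x<y y≤z)
<∞-≤∞-trans (fin<fin _)   (_ ≤∞∞)       = fin<∞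
<∞-≤∞-trans fin<∞         (_ ≤∞∞)       = fin<∞

≤∞-<∞-trans : ∀ {x y z} → x ≤∞ y → y <∞ z → x <∞ z
≤∞-<∞-trans (fin≤fin x≤y) (fin<fin y<z) = fin<fin (ℕₚ.≤-<-trans x≤y y<z)
≤∞-<∞-trans (fin≤fin _)   fin<∞         = fin<∞

<∞-irrefl : ∀ {x} → ¬ (x <∞ x)
<∞-irrefl (fin<fin x<x) = ℕₚ.<-irrefl refl x<x

fin-injective : ∀ {m n} → fin m ≡ fin n → m ≡ n
fin-injective refl = refl

module _ {lam : Partition} where

  val-in : ∀ {π x} → x ∈Y lam → val lam π x ≡ fin (π x)
  val-in {x = suc i , suc j} (_ , _ , j≤row) with suc j ≤? rowLen (parts lam) (suc i)
  ... | yes _     = refl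
  ... | no  j≰row = ⊥-elim (j≰row j≤row)

  val-cong : ∀ {π π′} x → π′ x ≡ π x → val lam π′ x ≡ val lam π x
  val-cong (zero , _)        _  = refl
  val-cong (suc _ , zero)    _  = refl
  val-cong (suc i , suc j)   eq with suc j ≤? rowLen (parts lam) (suc i)
  ... | yes _ = cong fin eq
  ... | no  _ = refl

  val-mono : ∀ {π π′} x → π′ x ℕ.≤ π x → val lam π′ x ≤∞ val lam π x
  val-mono (zero , _)      _  = fin≤fin z≤n
  val-mono (suc _ , zero)  _  = fin≤fin z≤n
  val-mono (suc i , suc j) le with suc j ≤? rowLen (parts lam) (suc i)
  ... | yes _ = fin≤fin le
  ... | no  _ = ∞ ≤∞∞

module _ (π : Filling) (P : List Cell) where

  −P-∉ : ∀ {x} → x ∉ P → (π −P P) x ≡ π x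
  −P-∉ {x} x∉P with x ∈?C P
  ... | yes x∈P = ⊥-elim (x∉P x∈P)
  ... | no  _   = refl

  −P-∈ : ∀ {x} → x ∈ P → (π −P P) x ≡ π x ∸ 1
  −P-∈ {x} x∈P with x ∈?C P
  ... | yes _   = refl
  ... | no  x∉P = ⊥-elim (x∉P x∈P)

  −P-≤ : ∀ x → (π −P P) x ℕ.≤ π x
  −P-≤ x with x ∈?C P
  ... | yes _ = ℕₚ.m∸n≤m (π x) 1
  ... | no  _ = ℕₚ.≤-refl

module _ {lam : Partition} {cc : CornerContents lam} {π : Filling} where

  IsQ-uncons : ∀ {v x P} → IsQ cc π v (x ∷ P) →
    x ≡ v × v ∈Y lam × (P ≡ [] ⊎ ∃ λ w → (w ≡ eC v ⊎ w ≡ nC v) × IsQ cc π w P)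
  IsQ-uncons (north v∈λ _ _ q)  = refl , v∈λ , inj₂ (_ , inj₂ refl , q)
  IsQ-uncons (eastIA v∈λ _ q)   = refl , v∈λ , inj₂ (_ , inj₁ refl , q)
  IsQ-uncons (eastGt v∈λ _ _ q) = refl , v∈λ , inj₂ (_ , inj₁ refl , q)
  IsQ-uncons (stop v∈λ _ _)     = refl , v∈λ , inj₁ refl

  IsQ-⊆ : ∀ {v P x} → IsQ cc π v P → x ∈ P → x ∈Y lam
  IsQ-⊆ q (here refl) with IsQ-uncons q
  ... | refl , v∈λ , _ = v∈λ
  IsQ-⊆ q (there x∈P) with IsQ-uncons q
  IsQ-⊆ q (there ())  | _ , _ , inj₁ refl
  IsQ-⊆ q (there x∈P) | _ , _ , inj₂ (_ , _ , q′) = IsQ-⊆ q′ x∈P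

  IsQ-predecessor : ∀ {v P x} → IsQ cc π v P → x ∈ P → x ≡ v ⊎ ∃ λ y → y ∈ P × (x ≡ eC y ⊎ x ≡ nC y)
  IsQ-predecessor q (here refl) = inj₁ (proj₁ (IsQ-uncons q))
  IsQ-predecessor q (there x∈P) with IsQ-uncons q
  IsQ-predecessor q (there ())  | _ , _ , inj₁ refl
  IsQ-predecessor q (there x∈P) | refl , _ , inj₂ (_ , w-follows-v , q′) with IsQ-predecessor q′ x∈P
  ... | inj₁ refl             = inj₂ (_ , here refl , w-follows-v)
  ... | inj₂ (y , y∈P , x-follows-y) = inj₂ (y , there y∈P , x-follows-y)

  IsQ-north-neighbour : ∀ {v P i j} → IsQ cc π v P → (i , suc j) ∈ P → (suc i , suc j) ∉ P →
    (i , suc j) ≡ v ⊎ (i , j) ∈ P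
  IsQ-north-neighbour q n∈P u∉P with IsQ-predecessor q n∈P
  ... | inj₁ n≡v                              = inj₁ n≡v
  ... | inj₂ (_ , y∈P , inj₁ refl)            = inj₂ y∈P
  ... | inj₂ ((suc _ , _) , y∈P , inj₂ refl)  = ⊥-elim (u∉P y∈P)
  ... | inj₂ ((zero , _) , y∈P , inj₂ _) with IsQ-⊆ q y∈P
  ...   | () , _

module Decrease {lam : Partition} (cc : CornerContents lam) (π : Filling) (P : List Cell)
                (P⊆λ : ∀ {x} → x ∈ P → x ∈Y lam) (compat : Compatible cc P π) where

  private
    π′ : Filling
    π′ = π −P P

  val-−P-∉ : ∀ {x} → x ∉ P → val lam π′ x ≡ val lam π x
  val-−P-∉ {x} x∉P = val-cong x (−P-∉ π P x∉P)

  val-−P-≤ : ∀ x → val lam π′ x ≤∞ val lam π x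
  val-−P-≤ x = val-mono x (−P-≤ π P x)

  val-−P-∈ : ∀ {x} → x ∈ P → val lam π′ x ≡ fin (π x ∸ 1)
  val-−P-∈ x∈P = trans (val-in (P⊆λ x∈P)) (cong fin (−P-∈ π P x∈P))

  −P-preserves-≡ : ∀ {x y} → x ∈ P → y ∈ P → val lam π x ≡ val lam π y → val lam π′ x ≡ val lam π′ y
  −P-preserves-≡ {x} {y} x∈P y∈P eq = begin
    val lam π′ x  ≡⟨ val-−P-∈ x∈P ⟩
    fin (π x ∸ 1) ≡⟨ cong (λ n → fin (n ∸ 1)) πx≡πy ⟩
    fin (π y ∸ 1) ≡⟨ sym (val-−P-∈ y∈P) ⟩
    val lam π′ y  ∎
    where
    open ≡-Reasoning
    πx≡πy : π x ≡ π y
    πx≡πy = fin-injective (trans (sym (val-in (P⊆λ x∈P))) (trans eq (val-in (P⊆λ y∈P))))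

  −P-reflects-< : ∀ {x y} → x ∈ P → y ∈ P → val lam π′ x <∞ val lam π′ y → val lam π x <∞ val lam π y
  −P-reflects-< x∈P y∈P lt with subst₂ _<∞_ (val-−P-∈ x∈P) (val-−P-∈ y∈P) lt
  ... | fin<fin lt′ = subst₂ _<∞_ (sym (val-in (P⊆λ x∈P))) (sym (val-in (P⊆λ y∈P))) (fin<fin (ℕₚ.pred-cancel-< lt′))

  west-<-lifts : ∀ x → (x ∈Y lam → 𝓘 cc x ⊎ 𝓐 cc x) →
    val lam π′ x <∞ val lam π′ (eC x) → val lam π x <∞ val lam π (eC x)
  west-<-lifts x x∈𝓘⊎𝓐 lt with x ∈?C P
  ... | no x∉P  = <∞-≤∞-trans (subst (_<∞ val lam π′ (eC x)) (val-−P-∉ x∉P) lt) (val-−P-≤ (eC x))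
  ... | yes x∈P with proj₁ compat x x∈P (x∈𝓘⊎𝓐 (P⊆λ x∈P))
  ...   | ex∈P , x≈ex = ⊥-elim (<∞-irrefl (subst (_<∞ val lam π′ (eC x)) (−P-preserves-≡ x∈P ex∈P x≈ex) lt))

  east-≤-south : IsRPP lam π → ∀ {x} → x ∈ P → 𝓘 cc x ⊎ 𝓐 cc x → val lam π (eC x) ≤∞ val lam π (sC x)
  east-≤-south rpp {x} x∈P x∈𝓘⊎𝓐 = subst (_≤∞ val lam π (sC x)) (proj₂ (proj₁ compat x x∈P x∈𝓘⊎𝓐)) (proj₂ (rpp x (P⊆λ x∈P)))

  north-<-lifts : IsRPP lam π → ∀ {v i j} → IsQ cc π v P → (suc i , suc j) ⊴ v → 𝓐 cc (suc i , suc j) →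
    val lam π (suc i , j) <∞ val lam π (suc i , suc j) →
    val lam π′ (i , suc j) <∞ val lam π′ (suc i , suc j) → val lam π (i , suc j) <∞ val lam π (suc i , suc j)
  north-<-lifts rpp {i = i} {j} q u⊴v u∈𝓐 w<u n<u with (i , suc j) ∈?C P | (suc i , suc j) ∈?C P
  ... | no  n∉P | _       = <∞-≤∞-trans (subst (_<∞ val lam π′ (suc i , suc j)) (val-−P-∉ n∉P) n<u) (val-−P-≤ (suc i , suc j))
  ... | yes n∈P | yes u∈P = −P-reflects-< n∈P u∈P n<u
  ... | yes n∈P | no  u∉P with IsQ-north-neighbour q n∈P u∉P
  ...   | inj₁ refl = ⊥-elim (⋬-north i (suc j) u⊴v)
  ...   | inj₂ nw∈P = ≤∞-<∞-trans (east-≤-south rpp nw∈P (inj₂ nw∈𝓐)) w<u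
    where
    nw∈𝓐 : 𝓐 cc (i , j)
    nw∈𝓐 = 𝓐-content cc (P⊆λ nw∈P) (sym (content-diagonal i j)) u∈𝓐

mainTheorem11 : (lam : Partition) (cc : CornerContents lam) (π : Filling) →
    IsRPP lam π →
    (u v : Cell) → u ∈Y lam → ¬ cand cc π u → cand cc π v →
    (Q : List Cell) → IsQ cc π v Q →
    Compatible cc Q π → IsRPP lam (π −P Q) →
    u ◁ v → ¬ cand cc (π −P Q) u
mainTheorem11 lam cc π rpp (zero , _)      v (() , _)     _ _ Q _ _ _ _
mainTheorem11 lam cc π rpp (suc _ , zero)  v (_ , () , _) _ _ Q _ _ _ _
mainTheorem11 lam cc π rpp (suc i , suc j) v u∈λ u∉cand _ Q q compat _ (u⊴v , _) = u∉cand ∘ lift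
  where
  open Decrease cc π Q (IsQ-⊆ q) compat

  lift : cand cc (π −P Q) (suc i , suc j) → cand cc π (suc i , suc j)
  lift (inj₁ (u∈𝓞 , w<′u)) = inj₁ (u∈𝓞 , west-<-lifts _ (λ w∈λ → west-of-𝓞 cc w∈λ u∈𝓞) w<′u)
  lift (inj₂ (u∈𝓐 , w<′u , n<′u)) = inj₂ (u∈𝓐 , w<u , north-<-lifts rpp q u⊴v u∈𝓐 w<u n<′u)
    where
    w<u : val lam π (suc i , j) <∞ val lam π (suc i , suc j)
    w<u = west-<-lifts _ (λ w∈λ → west-of-𝓐 cc w∈λ u∈𝓐) w<′u
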